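{- Let $\sigma\in S_n$ and let $v_1\cdots v_n$ be its place-based non-inversion table. Then $j\in\{1,\ldots,n\}$ is a strong fixed point of $\sigma$ if and only if $v_j=j$ and $v_k>j$ for all $k>j$.
   Context: The place-based non-inversion table of $\sigma\in S_n$ is the word $v_1\cdots v_n$ with $v_j=1+|\{i<j:\sigma(i)<\sigma(j)\}|$. A number $i\in\{1,\ldots,n\}$ is a strong fixed point of $\sigma$ if $\sigma(i)=i$ and $\sigma(\{1,\ldots,i\})=\{1,\ldots,i\}$. -}

module Defs where

open import Data.Nat using (ℕ; suc; _<_; _≤_)
open import Data.Fin using (Fin; toℕ) renaming (_<_ to _<ᶠ_; _≤_ to _≤ᶠ_)
open import Data.Fin.Properties using (_<?_)
open import Data.Fin.Permutation using (Permutation′; _⟨$⟩ʳ_)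
open import Data.Fin.Subset using (Subset; ∣_∣; _⊆_)
open import Data.Fin.Subset.Properties using ()
open import Data.Vec using (tabulate)
open import Data.Bool using (_∧_)
open import Data.Product using (Σ; _×_; _,_)
open import Relation.Binary.PropositionalEquality using (_≡_)
open import Relation.Nullary.Decidable using (⌊_⌋)

-- Positions 1..n are represented by Fin n (position j corresponds to toℕ j + 1);
-- σ ∈ S_n is a permutation of Fin n, with σ(i) = σ ⟨$⟩ʳ i.

nonInvEntry : ∀ {n} → Permutation′ n → Fin n → ℕ
nonInvEntry {n} σ j =
  suc ∣ tabulate (λ i → ⌊ i <? j ⌋ ∧ ⌊ (σ ⟨$⟩ʳ i) <? (σ ⟨$⟩ʳ j) ⌋) ∣

pos : ∀ {n} → Fin n → ℕ
pos j = suc (toℕ j)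

strongFixedPoint : ∀ {n} → Permutation′ n → Fin n → Set
strongFixedPoint {n} σ j =
  (σ ⟨$⟩ʳ j ≡ j) ×
  (((i : Fin n) → i ≤ᶠ j → (σ ⟨$⟩ʳ i) ≤ᶠ j) ×
   ((k : Fin n) → k ≤ᶠ j → Σ (Fin n) (λ i → (i ≤ᶠ j) × (σ ⟨$⟩ʳ i ≡ k))))

module Submission where

open import Defs
open import Data.Nat using (ℕ; _<_)
open import Data.Fin using (Fin) renaming (_<_ to _<ᶠ_)
open import Data.Fin.Permutation using (Permutation′)
open import Data.Product using (_×_)
open import Function.Bundles using (_⇔_)
open import Relation.Binary.PropositionalEquality using (_≡_)

open import Data.Nat using (zero; suc; _≤_; z≤n; s≤s)
import Data.Nat.Properties as ℕ
open import Data.Fin using (toℕ; fromℕ<; inject≤) renaming (_≤_ to _≤ᶠ_)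
open import Data.Fin.Properties
  using (toℕ-injective; toℕ<n; injective⇒≤; fromℕ<-injective; inject≤-injective; toℕ-inject≤)
  renaming (_<?_ to _<ᶠ?_; _≤?_ to _≤ᶠ?_)
open import Data.Fin.Induction using (<-wellFounded)
open import Data.Fin.Permutation using (_⟨$⟩ʳ_; _⟨$⟩ˡ_; inverseˡ; inverseʳ)
open import Data.Fin.Subset using (Subset; ∣_∣; _∈_; _⊆_)
open import Data.Fin.Subset.Properties using (p⊆q⇒∣p∣≤∣q∣; p⊂q⇒∣p∣<∣q∣; ⊆-antisym; _∈?_)
open import Data.Vec using (tabulate)
open import Data.Vec.Properties using (lookup∘tabulate; []=⇒lookup; lookup⇒[]=)
open import Data.Bool using (Bool; T; _∧_)
open import Data.Bool.Properties using (T-≡; T-∧)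
open import Data.Product using (Σ; _,_; proj₁; proj₂)
open import Data.Product.Function.NonDependent.Propositional using (_×-⇔_)
open import Function using (_∘_)
open import Function.Bundles using (mk⇔; Equivalence)
open import Function.Definitions using (Injective)
import Function.Properties.Equivalence as ⇔
open import Induction.WellFounded using (Acc; acc)
open import Relation.Binary.PropositionalEquality using (refl; sym; trans; cong; subst)
open import Relation.Nullary using (yes; no; contradiction)
open import Relation.Nullary.Decidable using (Dec; ⌊_⌋; toWitness; fromWitness)
open import Relation.Unary using (Decidable)

-- Positions and values are 0-based elements of Fin n, so "v_j = j" reads v_j = 1 + j.
--
-- Idea of the proof.  Write N(k) = {i < k : σ(i) < σ(k)}, so that v_k = 1 + |N(k)|.
-- The theorem splits into two independent equivalences:
--
--   (1) v_j = 1 + j, i.e. |N(j)| = j, iff σ(i) < σ(j) for every i < j;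
--   (2) v_k > 1 + j for all k > j iff σ(i) < σ(k) whenever i ≤ j < k  ("j separates σ");
--
-- together with the purely combinatorial fact
--
--   (3) j is a strong fixed point iff j is a prefix maximum (σ(i) < σ(j) for i < j)
--       and j separates σ.
--
-- (1) and (2) are counting arguments with subsets of Fin n: N(k) always lies inside the
-- initial segment {0,…,k-1}, and a subset of an initial segment that is at least as large
-- as it must be all of it; the backward half of (2) additionally needs a well-founded
-- induction on the value σ(k).  (3) uses a pigeonhole principle for injections, applied
-- to σ and σ⁻¹, to show σ(j) = j.

∈tabulate⇔ : ∀ {n} (f : Fin n → Bool) {i : Fin n} → i ∈ tabulate f ⇔ T (f i)
∈tabulate⇔ f {i} = mk⇔
  (λ i∈ → Equivalence.from T-≡ (trans (sym (lookup∘tabulate f i)) ([]=⇒lookup i∈)))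
  (λ fi → lookup⇒[]= i _ (trans (lookup∘tabulate f i) (Equivalence.to T-≡ fi)))

T⌊⌋⇔ : ∀ {A : Set} (a? : Dec A) → T ⌊ a? ⌋ ⇔ A
T⌊⌋⇔ a? = mk⇔ toWitness fromWitness

⟪_⟫ : ∀ {n} {P : Fin n → Set} → Decidable P → Subset n
⟪ P? ⟫ = tabulate (λ i → ⌊ P? i ⌋)

∈⟪⟫⇔ : ∀ {n} {P : Fin n → Set} (P? : Decidable P) {i : Fin n} → i ∈ ⟪ P? ⟫ ⇔ P i
∈⟪⟫⇔ P? {i} = ⇔.trans (∈tabulate⇔ _) (T⌊⌋⇔ (P? i))

below : ∀ {n} → ℕ → Subset n
below m = ⟪ (λ i → toℕ i ℕ.<? m) ⟫

∣below∣ : ∀ {n} m → m ≤ n → ∣ below {n} m ∣ ≡ m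
∣below∣ {zero}  zero    z≤n       = refl
∣below∣ {suc n} zero    z≤n       = ∣below∣ {n} zero z≤n
∣below∣ {suc n} (suc m) (s≤s m≤n) = cong suc (trans (cong ∣_∣ tail≡below) (∣below∣ m m≤n))
  where
  -- the tail of the segment {0,…,m} in Fin (suc n) is the segment {0,…,m-1} in Fin n
  tail≡below : ⟪ (λ i → suc (toℕ i) ℕ.<? suc m) ⟫ ≡ below {n} m
  tail≡below = ⊆-antisym
    (λ i∈ → Equivalence.from (∈⟪⟫⇔ _) (ℕ.≤-pred (Equivalence.to (∈⟪⟫⇔ _) i∈)))
    (λ i∈ → Equivalence.from (∈⟪⟫⇔ _) (s≤s (Equivalence.to (∈⟪⟫⇔ _) i∈)))

⊆-rigid : ∀ {n} {p q : Subset n} → p ⊆ q → ∣ q ∣ ≤ ∣ p ∣ → q ⊆ p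
⊆-rigid {p = p} p⊆q ∣q∣≤∣p∣ {x} x∈q with x ∈? p
... | yes x∈p = x∈p
... | no  x∉p = contradiction (p⊂q⇒∣p∣<∣q∣ (p⊆q , x , x∈q , x∉p)) (ℕ.≤⇒≯ ∣q∣≤∣p∣)

below⊆⇒≤∣∣ : ∀ {n} {p : Subset n} m → m ≤ n → below m ⊆ p → m ≤ ∣ p ∣
below⊆⇒≤∣∣ {p = p} m m≤n below⊆p =
  subst (_≤ ∣ p ∣) (∣below∣ m m≤n) (p⊆q⇒∣p∣≤∣q∣ below⊆p)

⊆below⇒below⊆ : ∀ {n} {p : Subset n} m → m ≤ n → p ⊆ below m → m ≤ ∣ p ∣ → below m ⊆ p
⊆below⇒below⊆ {p = p} m m≤n p⊆below m≤∣p∣ =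
  ⊆-rigid p⊆below (subst (_≤ ∣ p ∣) (sym (∣below∣ m m≤n)) m≤∣p∣)

injective⇒bound : ∀ {n m} {f : Fin n → Fin m} → Injective _≡_ _≡_ f →
  ∀ a b → a < n → (∀ x → toℕ x ≤ a → toℕ (f x) ≤ b) → a ≤ b
injective⇒bound {n} {f = f} f-inj a b a<n f≤b = ℕ.≤-pred (injective⇒≤ g-inj)
  where
  embed : Fin (suc a) → Fin n
  embed w = inject≤ w a<n
  embed≤a : ∀ w → toℕ (embed w) ≤ a
  embed≤a w = subst (_≤ a) (sym (toℕ-inject≤ w a<n)) (ℕ.≤-pred (toℕ<n w))
  g : Fin (suc a) → Fin (suc b)
  g w = fromℕ< (s≤s (f≤b (embed w) (embed≤a w)))
  g-inj : Injective _≡_ _≡_ g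
  g-inj {u} {w} gu≡gw = inject≤-injective a<n a<n u w
    (f-inj (toℕ-injective (fromℕ<-injective _ _ _ _ gu≡gw)))

module _ {n : ℕ} (σ : Permutation′ n) where

  σ-injective : Injective _≡_ _≡_ (σ ⟨$⟩ʳ_)
  σ-injective {a} {b} σa≡σb =
    trans (sym (inverseˡ σ)) (trans (cong (σ ⟨$⟩ˡ_) σa≡σb) (inverseˡ σ))

  σ⁻¹-injective : Injective _≡_ _≡_ (σ ⟨$⟩ˡ_)
  σ⁻¹-injective {a} {b} σ⁻¹a≡σ⁻¹b =
    trans (sym (inverseʳ σ)) (trans (cong (σ ⟨$⟩ʳ_) σ⁻¹a≡σ⁻¹b) (inverseʳ σ))

  nonInv : Fin n → Subset n
  nonInv k = tabulate (λ i → ⌊ i <ᶠ? k ⌋ ∧ ⌊ σ ⟨$⟩ʳ i <ᶠ? σ ⟨$⟩ʳ k ⌋)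

  ∈nonInv⇔ : ∀ {i k} → i ∈ nonInv k ⇔ (i <ᶠ k × σ ⟨$⟩ʳ i <ᶠ σ ⟨$⟩ʳ k)
  ∈nonInv⇔ {i} {k} = ⇔.trans (∈tabulate⇔ _)
    (⇔.trans T-∧ (T⌊⌋⇔ (i <ᶠ? k) ×-⇔ T⌊⌋⇔ (σ ⟨$⟩ʳ i <ᶠ? σ ⟨$⟩ʳ k)))

  nonInv⊆below : ∀ k → nonInv k ⊆ below (toℕ k)
  nonInv⊆below k i∈ = Equivalence.from (∈⟪⟫⇔ _) (proj₁ (Equivalence.to ∈nonInv⇔ i∈))

  ∣nonInv∣≤ : ∀ k → ∣ nonInv k ∣ ≤ toℕ k
  ∣nonInv∣≤ k = subst (∣ nonInv k ∣ ≤_) (∣below∣ (toℕ k) (ℕ.<⇒≤ (toℕ<n k)))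
    (p⊆q⇒∣p∣≤∣q∣ (nonInv⊆below k))

  count-lower : ∀ k m → m ≤ toℕ k → (∀ i → toℕ i < m → σ ⟨$⟩ʳ i <ᶠ σ ⟨$⟩ʳ k) →
    m ≤ ∣ nonInv k ∣
  count-lower k m m≤k smaller = below⊆⇒≤∣∣ m (ℕ.≤-trans m≤k (ℕ.<⇒≤ (toℕ<n k))) below⊆N
    where
    below⊆N : below m ⊆ nonInv k
    below⊆N {i} i∈ = let i<m = Equivalence.to (∈⟪⟫⇔ _) i∈ in
      Equivalence.from ∈nonInv⇔ (ℕ.<-≤-trans i<m m≤k , smaller i i<m)

  count-saturates : ∀ k m → m ≤ n → nonInv k ⊆ below m → m ≤ ∣ nonInv k ∣ →
    ∀ i → toℕ i < m → σ ⟨$⟩ʳ i <ᶠ σ ⟨$⟩ʳ k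
  count-saturates k m m≤n N⊆below m≤∣N∣ i i<m =
    proj₂ (Equivalence.to ∈nonInv⇔
      (⊆below⇒below⊆ m m≤n N⊆below m≤∣N∣ (Equivalence.from (∈⟪⟫⇔ _) i<m)))

  PrefixMax : Fin n → Set
  PrefixMax k = ∀ i → i <ᶠ k → σ ⟨$⟩ʳ i <ᶠ σ ⟨$⟩ʳ k

  prefixMax⇔ : ∀ k → PrefixMax k ⇔ (nonInvEntry σ k ≡ pos k)
  prefixMax⇔ k = mk⇔
    (λ prefixMax → cong suc (ℕ.≤-antisym (∣nonInv∣≤ k) (count-lower k (toℕ k) ℕ.≤-refl prefixMax)))
    (λ vₖ≡k → count-saturates k (toℕ k) (ℕ.<⇒≤ (toℕ<n k)) (nonInv⊆below k)
                (ℕ.≤-reflexive (sym (ℕ.suc-injective vₖ≡k))))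

  Separates : Fin n → Set
  Separates j = ∀ i k → i ≤ᶠ j → j <ᶠ k → σ ⟨$⟩ʳ i <ᶠ σ ⟨$⟩ʳ k

  -- The hard direction is a
  -- well-founded induction on σ(k): if some i ≤ j had σ(i) > σ(k), every member x of N(k)
  -- must satisfy x ≤ j (for x > j the induction hypothesis gives σ(i) < σ(x) < σ(k)), so
  -- N(k) ⊆ {0,…,j}; having at least j+1 elements it contains i, a contradiction.
  separates⇔ : ∀ j → Separates j ⇔ (∀ k → j <ᶠ k → pos j < nonInvEntry σ k)
  separates⇔ j = mk⇔
    (λ sep k j<k → s≤s (count-lower k (suc (toℕ j)) j<k (λ i i≤j → sep i k (ℕ.≤-pred i≤j) j<k)))
    (λ large i k i≤j j<k → separated large k (<-wellFounded (σ ⟨$⟩ʳ k)) j<k i i≤j)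
    where
    separated : (∀ k → j <ᶠ k → pos j < nonInvEntry σ k) →
      ∀ k → Acc _<ᶠ_ (σ ⟨$⟩ʳ k) → j <ᶠ k → ∀ i → i ≤ᶠ j → σ ⟨$⟩ʳ i <ᶠ σ ⟨$⟩ʳ k
    separated large k (acc smaller) j<k i i≤j with σ ⟨$⟩ʳ i <ᶠ? σ ⟨$⟩ʳ k
    ... | yes σi<σk = σi<σk
    ... | no  σi≮σk = contradiction
      (count-saturates k (suc (toℕ j)) (ℕ.<-trans j<k (toℕ<n k)) N⊆below
        (ℕ.≤-pred (large k j<k)) i (s≤s i≤j))
      σi≮σk
      where
      N⊆below : nonInv k ⊆ below (suc (toℕ j))
      N⊆below {x} x∈ with Equivalence.to ∈nonInv⇔ x∈ | toℕ x ℕ.≤? toℕ j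
      ... | _ | yes x≤j = Equivalence.from (∈⟪⟫⇔ _) (s≤s x≤j)
      ... | (_ , σx<σk) | no x≰j = contradiction
        (ℕ.<-trans (separated large x (smaller σx<σk) (ℕ.≰⇒> x≰j) i i≤j) σx<σk) σi≮σk

  strongFixed⇒ : ∀ j → strongFixedPoint σ j → PrefixMax j × Separates j
  strongFixed⇒ j (fix , into , onto) = prefixMax , separates
    where
    prefixMax : PrefixMax j
    prefixMax i i<j = ℕ.≤∧≢⇒<
      (subst (λ x → σ ⟨$⟩ʳ i ≤ᶠ x) (sym fix) (into i (ℕ.<⇒≤ i<j)))
      (λ σi≡σj → ℕ.<⇒≢ i<j (cong toℕ (σ-injective (toℕ-injective σi≡σj))))
    -- a value ≤ j is already hit from {0,…,j}, so σ(k) > j for every position k > j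
    j<σk : ∀ k → j <ᶠ k → j <ᶠ σ ⟨$⟩ʳ k
    j<σk k j<k with σ ⟨$⟩ʳ k ≤ᶠ? j
    ... | no  σk≰j = ℕ.≰⇒> σk≰j
    ... | yes σk≤j with onto (σ ⟨$⟩ʳ k) σk≤j
    ... | i , i≤j , σi≡σk = contradiction (subst (_≤ᶠ j) (σ-injective σi≡σk) i≤j) (ℕ.<⇒≱ j<k)
    separates : Separates j
    separates i k i≤j j<k = ℕ.≤-<-trans (into i i≤j) (j<σk k j<k)

  -- (3), backward: σ maps {0,…,j} injectively into {0,…,σ(j)} and σ⁻¹ maps {0,…,σ(j)}
  -- injectively into {0,…,j}; by pigeonhole σ(j) = j, and both blocks are preserved.
  ⇒strongFixed : ∀ j → PrefixMax j × Separates j → strongFixedPoint σ j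
  ⇒strongFixed j (prefixMax , separates) = fix , into , onto
    where
    σ-bound : ∀ i → i ≤ᶠ j → σ ⟨$⟩ʳ i ≤ᶠ σ ⟨$⟩ʳ j
    σ-bound i i≤j with toℕ i ℕ.≟ toℕ j
    ... | yes i≡j = ℕ.≤-reflexive (cong (toℕ ∘ (σ ⟨$⟩ʳ_)) (toℕ-injective i≡j))
    ... | no  i≢j = ℕ.<⇒≤ (prefixMax i (ℕ.≤∧≢⇒< i≤j i≢j))
    σ⁻¹-bound : ∀ w → w ≤ᶠ σ ⟨$⟩ʳ j → σ ⟨$⟩ˡ w ≤ᶠ j
    σ⁻¹-bound w w≤σj with σ ⟨$⟩ˡ w ≤ᶠ? j
    ... | yes σ⁻¹w≤j = σ⁻¹w≤j
    ... | no  σ⁻¹w≰j = contradiction w≤σj (ℕ.<⇒≱ (subst (σ ⟨$⟩ʳ j <ᶠ_) (inverseʳ σ)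
            (separates j (σ ⟨$⟩ˡ w) ℕ.≤-refl (ℕ.≰⇒> σ⁻¹w≰j))))
    j≤σj : j ≤ᶠ σ ⟨$⟩ʳ j
    j≤σj = injective⇒bound σ-injective (toℕ j) (toℕ (σ ⟨$⟩ʳ j)) (toℕ<n j) σ-bound
    σj≤j : σ ⟨$⟩ʳ j ≤ᶠ j
    σj≤j = injective⇒bound σ⁻¹-injective (toℕ (σ ⟨$⟩ʳ j)) (toℕ j) (toℕ<n (σ ⟨$⟩ʳ j)) σ⁻¹-bound
    fix : σ ⟨$⟩ʳ j ≡ j
    fix = toℕ-injective (ℕ.≤-antisym σj≤j j≤σj)
    into : ∀ i → i ≤ᶠ j → σ ⟨$⟩ʳ i ≤ᶠ j
    into i i≤j = ℕ.≤-trans (σ-bound i i≤j) σj≤j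
    onto : ∀ k → k ≤ᶠ j → Σ (Fin n) (λ i → (i ≤ᶠ j) × (σ ⟨$⟩ʳ i ≡ k))
    onto k k≤j = σ ⟨$⟩ˡ k , σ⁻¹-bound k (ℕ.≤-trans k≤j j≤σj) , inverseʳ σ

lemma4p13 : (n : ℕ) (σ : Permutation′ n) (j : Fin n) →
    strongFixedPoint σ j ⇔
      ((nonInvEntry σ j ≡ pos j) × ((k : Fin n) → j <ᶠ k → pos j < nonInvEntry σ k))
lemma4p13 n σ j = ⇔.trans
  (mk⇔ (strongFixed⇒ σ j) (⇒strongFixed σ j))
  (prefixMax⇔ σ j ×-⇔ separates⇔ σ j)
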